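{- Let $0=s_1<\dots<s_k$ be integers, $S=\{s_1,\dots,s_k\}$, $\bar s=s_k$, $n\ge2\bar s$. Then $$T(n)=\sum_{X\in\mathcal P}\beta_X\,T_X(n)\qquad\text{and}\qquad T_X(n+1)=\sum_{X'\in\mathcal P}\alpha_{X,X'}\,T_{X'}(n)\ \text{ for every }X\in\mathcal P.$$
   Context: $V(n)=\{0,\dots,n-1\}$. $C_n$ is the graph on $V(n)$ with edge set $E_C(n)=\{(i,j):(j-i)\bmod n\in S\}$, and $L_n$ is the graph on $V(n)$ with edge set $E_L(n)=\{(i,j):j-i\in S\}$. Put $\mathrm{Hook}(n)=E_C(n)\setminus E_L(n)$, $\mathrm{New}(n)=E_L(n+1)\setminus E_L(n)$, $L(n)=\{0,\dots,\bar s-1\}$, $R(n)=\{n-\bar s,\dots,n-1\}$. $\mathrm{ID}_T,\mathrm{OD}_T$ denote in- and out-degree with respect to the edge set $T$. A cycle-cover of $C_n$ is $T\subseteq E_C(n)$ with all in- and out-degrees equal to $1$, and $T(n)$ is the number of cycle-covers of $C_n$. A legal cover of $L_n$ is $T\subseteq E_L(n)$ with all degrees $\le1$, $\mathrm{ID}_T(v)=1$ for $v\notin L(n)$, and $\mathrm{OD}_T(v)=1$ for $v\notin R(n)$. $\mathcal P$ is the set of pairs of binary $\bar s$-tuples (entries in $\{0,1\}$, indexed $0,\dots,\bar s-1$). The classification of a legal cover $T$ is $C(T)=(L^T,R^T)$ with $L^T(i)=\mathrm{ID}_T(i)$ and $R^T(i)=\mathrm{OD}_T(n-1-i)$, and $T_X(n)$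 is the number of legal covers of $L_n$ with classification $X$. For $X=(L,R)$, let $\beta_X$ be the number of $S\subseteq\mathrm{Hook}(n)$ with $\mathrm{ID}_S(i)=1-L(i)$ and $\mathrm{OD}_S(n-1-i)=1-R(i)$ for all $0\le i<\bar s$. For $X=(L,R)$, $X'=(L',R')$ and $S'\subseteq\mathrm{New}(n)$, let $od(n-1-i)=R'(i)+\mathrm{OD}_{S'}(n-1-i)$ for $0\le i<\bar s$, $od(n)=\mathrm{OD}_{S'}(n)$, $id(n)=\mathrm{ID}_{S'}(n)$. Set $\alpha_{X,X',S'}=1$ if: $od\le1$ on $R(n)\cup\{n\}$; $id(n)=1$; $od(n-\bar s)=1$; $L=L'$; and $R(i)=od(n-i)$ for $0\le i<\bar s$. Otherwise $\alpha_{X,X',S'}=0$. Finally $\alpha_{X,X'}=\sum_{S'\subseteq\mathrm{New}(n)}\alpha_{X,X',S'}$. -}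

module Defs where

open import Data.Bool using (Bool; true; false; _∧_; _∨_; not; if_then_else_)
open import Data.Nat using (ℕ; zero; suc; _+_; _*_; _∸_; _≡ᵇ_; _≤ᵇ_)
open import Data.Integer as ℤ using (ℤ; +_)
open import Data.Integer.DivMod using (_%ℕ_)
open import Data.List using (List; []; _∷_; map; _++_; filterᵇ; length; upTo; cartesianProduct; concatMap)
open import Data.Bool.ListAction using (any; all)
open import Data.Nat.ListAction using (sum)
open import Data.Product using (_×_; _,_; proj₁; proj₂)
open import Data.Vec using (Vec; []; _∷_)
open import Data.Fin using (Fin; toℕ; zero; suc)
open import Relation.Nullary using (does)

Edge : Set
Edge = ℕ × ℕ

-- S is given as the list s_1 , ... , s_k; sbar = s_k (the last element).
lastOr : ℕ → List ℕ → ℕ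
lastOr d []       = d
lastOr d (x ∷ xs) = lastOr x xs

sbar : List ℕ → ℕ
sbar S = lastOr 0 S

-- z mod n (value in {0..n-1}); for n = 0 there are no vertices, value irrelevant.
modN : ℤ → ℕ → ℕ
modN z zero    = 0
modN z (suc m) = z %ℕ suc m

memℕ : ℕ → List ℕ → Bool
memℕ x = any (x ≡ᵇ_)

memℤ : ℤ → List ℤ → Bool
memℤ x = any (λ y → does (x ℤ.≟ y))

eqE : Edge → Edge → Bool
eqE (a , b) (c , d) = (a ≡ᵇ c) ∧ (b ≡ᵇ d)

memE : Edge → List Edge → Bool
memE e = any (eqE e)

pairs : ℕ → List Edge
pairs n = cartesianProduct (upTo n) (upTo n)

isC : List ℕ → ℕ → Edge → Bool
isC S n (i , j) = memℕ (modN (+ j ℤ.- + i) n) S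

EC : List ℕ → ℕ → List Edge
EC S n = filterᵇ (isC S n) (pairs n)

isL : List ℕ → Edge → Bool
isL S (i , j) = memℤ (+ j ℤ.- + i) (map +_ S)

EL : List ℕ → ℕ → List Edge
EL S n = filterᵇ (isL S) (pairs n)

Hook : List ℕ → ℕ → List Edge
Hook S n = filterᵇ (λ e → not (memE e (EL S n))) (EC S n)

New : List ℕ → ℕ → List Edge
New S n = filterᵇ (λ e → not (memE e (EL S n))) (EL S (suc n))

ID : List Edge → ℕ → ℕ
ID T v = length (filterᵇ (λ e → proj₂ e ≡ᵇ v) T)

OD : List Edge → ℕ → ℕ
OD T v = length (filterᵇ (λ e → proj₁ e ≡ᵇ v) T)

subsets : {A : Set} → List A → List (List A)
subsets []       = [] ∷ []
subsets (x ∷ xs) = map (x ∷_) (subsets xs) ++ subsets xs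

count : (List Edge → Bool) → List Edge → ℕ
count p E = length (filterᵇ p (subsets E))

isCycleCover : ℕ → List Edge → Bool
isCycleCover n T = all (λ v → (ID T v ≡ᵇ 1) ∧ (OD T v ≡ᵇ 1)) (upTo n)

Tn : List ℕ → ℕ → ℕ
Tn S n = count (isCycleCover n) (EC S n)

Lset : List ℕ → ℕ → List ℕ
Lset S n = upTo (sbar S)

Rset : List ℕ → ℕ → List ℕ
Rset S n = map (λ i → (n ∸ sbar S) + i) (upTo (sbar S))

-- legal covers of L_n (T ⊆ E_L(n) is ensured by enumerating subsets of E_L(n))
isLegal : List ℕ → ℕ → List Edge → Bool
isLegal S n T = all (λ v → (ID T v ≤ᵇ 1) ∧ (OD T v ≤ᵇ 1)
                         ∧ (memℕ v (Lset S n) ∨ (ID T v ≡ᵇ 1))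
                         ∧ (memℕ v (Rset S n) ∨ (OD T v ≡ᵇ 1))) (upTo n)

Tup : ℕ → Set
Tup m = Vec (Fin 2) m

P : List ℕ → Set
P S = Tup (sbar S) × Tup (sbar S)

-- i-th entry of a tuple as a natural number (0 if out of range; never used out of range)
entry : {m : ℕ} → Tup m → ℕ → ℕ
entry []       _       = 0
entry (x ∷ xs) zero    = toℕ x
entry (x ∷ xs) (suc i) = entry xs i

allTup : (m : ℕ) → List (Tup m)
allTup zero    = [] ∷ []
allTup (suc m) = concatMap (λ v → (zero ∷ v) ∷ (suc zero ∷ v) ∷ []) (allTup m)

allP : (S : List ℕ) → List (P S)
allP S = cartesianProduct (allTup (sbar S)) (allTup (sbar S))

sumP : (S : List ℕ) → (P S → ℕ) → ℕ
sumP S f = sum (map f (allP S))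

classifiedAs : (S : List ℕ) → ℕ → P S → List Edge → Bool
classifiedAs S n (L , R) T =
  all (λ i → (ID T i ≡ᵇ entry L i) ∧ (OD T (n ∸ 1 ∸ i) ≡ᵇ entry R i)) (upTo (sbar S))

TX : (S : List ℕ) → ℕ → P S → ℕ
TX S n X = count (λ T → isLegal S n T ∧ classifiedAs S n X T) (EL S n)

β : (S : List ℕ) → ℕ → P S → ℕ
β S n (L , R) = count (λ T → all (λ i → (ID T i ≡ᵇ (1 ∸ entry L i))
                                       ∧ (OD T (n ∸ 1 ∸ i) ≡ᵇ (1 ∸ entry R i)))
                                 (upTo (sbar S)))
                      (Hook S n)

-- od for the pair X', S' : od(n) = OD_{S'}(n), od(n-1-i) = R'(i) + OD_{S'}(n-1-i)
-- (only evaluated on R(n) ∪ {n})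
od : (S : List ℕ) → ℕ → P S → List Edge → ℕ → ℕ
od S n (L' , R') S' v =
  if v ≡ᵇ n then OD S' n else entry R' (n ∸ 1 ∸ v) + OD S' v

αcond : (S : List ℕ) → ℕ → P S → P S → List Edge → Bool
αcond S n (L , R) (L' , R') S' =
  all (λ v → od S n (L' , R') S' v ≤ᵇ 1) (n ∷ Rset S n)
  ∧ (ID S' n ≡ᵇ 1)
  ∧ (od S n (L' , R') S' (n ∸ sbar S) ≡ᵇ 1)
  ∧ all (λ i → entry L i ≡ᵇ entry L' i) (upTo (sbar S))
  ∧ all (λ i → entry R i ≡ᵇ od S n (L' , R') S' (n ∸ i)) (upTo (sbar S))

α : (S : List ℕ) → ℕ → P S → P S → ℕ
α S n X X' = count (αcond S n X X') (New S n)

module Submission where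

-- Every quantity in the statement counts the subsets of a finite edge list that pass a
-- Boolean test, i.e. is a sum of indicators over `subsets E`.  The proof rests on:
--  * Splitting (count-split): if a test is invariant under reordering the edge list (as
--    are all tests built from degrees), then counting subsets of E equals summing, over
--    subsets a of one part of E, the number of subsets b of the other part such that
--    a ++ b passes the test.
--  * Edge geometry (EdgeSets): splitting E_C(n) along E_L(n) leaves E_L(n) and Hook(n),
--    whose edges go from R(n) into L(n); splitting E_L(n+1) along E_L(n) leaves E_L(n)
--    and New(n), whose edges go from R(n) into the new vertex n.
--  * Pointwise counts: for a ⊆ E_L(n), the b ⊆ Hook(n) completing a to a cycle cover are
--    counted by [a legal]·β_{C(a)} (hook-completions), and the b ⊆ New(n) extending a to a
--    legal cover of L_{n+1} of class X by [a legal]·α_{X,C(a)} (new-completions).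
--  * Regrouping by classification (sum-by-classification):
--    Σ_{a ⊆ E_L(n)} [a legal]·G(C(a)) = Σ_X G(X)·T_X(n).
-- Chaining these (transfer) gives both identities.

open import Defs
open import Data.Nat using (ℕ; suc; _*_; _<_; _≤_)
open import Data.List using (List; _∷_)
open import Data.List.Relation.Unary.Linked using (Linked)
open import Data.Product using (_×_)
open import Relation.Binary.PropositionalEquality using (_≡_)

import Data.Integer as ℤ
import Data.List.Relation.Unary.Linked as Linked
open import Data.Bool using (Bool; true; false; _∧_; _∨_; not; T; T?)
open import Data.Bool.ListAction using (all; and)
open import Data.Bool.Properties using (T-∧; T-∨; T-≡; ∧-zeroʳ)
open import Data.Empty using (⊥-elim)
open import Data.Fin using (Fin; toℕ) renaming (zero to fz; suc to fs)
open import Data.Integer.Properties using ([+m]-[+n]≡m⊖n; ⊖-≥; ⊖-<) renaming (+-injective to ℤ+-injective)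
open import Data.List using ([]; map; _++_; filterᵇ; length; upTo; cartesianProduct; concatMap)
open import Data.List.Membership.Propositional using (_∈_; find)
open import Data.List.Membership.Propositional.Properties
  using (∈-++⁻; ∈-map⁻; ∈-map⁺; ∈-filter⁻; ∈-filter⁺; ∈-cartesianProduct⁻; ∈-cartesianProduct⁺; ∈-upTo⁺; ∈-upTo⁻)
open import Data.List.Properties
  using (map-++; map-∘; map-cong; map-applyUpTo; length-++; filter-++; filter-all; filter-none; upTo-∷ʳ; ++-identityʳ)
open import Data.List.Relation.Binary.Permutation.Propositional using (_↭_; prep; ↭-sym)
open import Data.List.Relation.Binary.Permutation.Propositional.Properties using (↭-length; filter-↭; shift)
open import Data.List.Relation.Unary.All as All using (All)
open import Data.List.Relation.Unary.All.Properties using (all⁺; all⁻)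
open import Data.List.Relation.Unary.Any as Any using (here; there)
open import Data.List.Relation.Unary.Any.Properties using (any⁺; any⁻; map⁺)
open import Data.Nat using (zero; _+_; _∸_; _≡ᵇ_; _≤ᵇ_; _<ᵇ_; _<?_; z≤n; s≤s; z<s)
open import Data.Nat.DivMod using (m<n⇒m%n≡m)
open import Data.Nat.ListAction using (sum)
open import Data.Nat.ListAction.Properties using (sum-++)
open import Data.Nat.Properties
open import Algebra.Properties.CommutativeSemigroup +-commutativeSemigroup using (x∙yz≈y∙xz)
open import Data.Product using (_,_; proj₁; proj₂; ∃)
open import Data.Sum using (_⊎_; inj₁; inj₂)
open import Data.Unit using (tt)
open import Data.Vec using ([]; _∷_)
open import Function using (_∘_)
open import Function.Bundles using (Equivalence)
open import Relation.Binary.PropositionalEquality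
  using (_≢_; refl; sym; trans; cong; cong₂; subst; subst₂; module ≡-Reasoning)
open import Relation.Nullary using (¬_; does; yes; no)

private
  variable
    A B : Set

T-ext : ∀ {a b} → (T a → T b) → (T b → T a) → a ≡ b
T-ext {true}  {true}  _ _ = refl
T-ext {true}  {false} f _ = ⊥-elim (f tt)
T-ext {false} {true}  _ g = ⊥-elim (g tt)
T-ext {false} {false} _ _ = refl

¬T⇒≡false : ∀ {b} → ¬ T b → b ≡ false
¬T⇒≡false {true}  ¬b = ⊥-elim (¬b tt)
¬T⇒≡false {false} _  = refl

all-upTo⁻ : (f : ℕ → Bool) (m : ℕ) → T (all f (upTo m)) → ∀ {i} → i < m → T (f i)
all-upTo⁻ f m h i<m = All.lookup (all⁺ f (upTo m) h) (∈-upTo⁺ i<m)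

all-upTo⁺ : (f : ℕ → Bool) (m : ℕ) → (∀ {i} → i < m → T (f i)) → T (all f (upTo m))
all-upTo⁺ f m h = all⁻ f (All.tabulate (λ i∈ → h (∈-upTo⁻ i∈)))

all-upTo-suc : (f : ℕ → Bool) (m : ℕ) → all f (upTo (suc m)) ≡ f 0 ∧ all (f ∘ suc) (upTo m)
all-upTo-suc f m =
  cong (λ l → f 0 ∧ and l) (trans (map-applyUpTo suc f m) (sym (map-applyUpTo (λ i → i) (f ∘ suc) m)))

all-∧ : (f g : A → Bool) (xs : List A) → all (λ x → f x ∧ g x) xs ≡ all f xs ∧ all g xs
all-∧ f g []       = refl
all-∧ f g (x ∷ xs) with f x | g x
... | true  | true  = all-∧ f g xs
... | true  | false = sym (∧-zeroʳ (all f xs))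
... | false | _     = refl

all-eqs⁻ : (f g h k : ℕ → ℕ) (m : ℕ) → T (all (λ i → (f i ≡ᵇ g i) ∧ (h i ≡ᵇ k i)) (upTo m)) →
  ∀ {i} → i < m → f i ≡ g i × h i ≡ k i
all-eqs⁻ f g h k m t {i} i<m with Equivalence.to (T-∧ {f i ≡ᵇ g i}) (all-upTo⁻ _ m t i<m)
... | fg , hk = ≡ᵇ⇒≡ (f i) (g i) fg , ≡ᵇ⇒≡ (h i) (k i) hk

all-eqs⁺ : (f g h k : ℕ → ℕ) (m : ℕ) → (∀ {i} → i < m → f i ≡ g i × h i ≡ k i) →
  T (all (λ i → (f i ≡ᵇ g i) ∧ (h i ≡ᵇ k i)) (upTo m))
all-eqs⁺ f g h k m eqs = all-upTo⁺ _ m (λ {i} i<m →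
  Equivalence.from T-∧ (≡⇒≡ᵇ (f i) (g i) (proj₁ (eqs i<m)) , ≡⇒≡ᵇ (h i) (k i) (proj₂ (eqs i<m))))

T-not⇒¬T : ∀ {b} → T (not b) → ¬ T b
T-not⇒¬T {true}  ()
T-not⇒¬T {false} _ ()

memℕ-sound : {x : ℕ} {xs : List ℕ} → T (memℕ x xs) → x ∈ xs
memℕ-sound {x} {xs} h = Any.map (λ {y} → ≡ᵇ⇒≡ x y) (any⁻ (x ≡ᵇ_) xs h)

memℕ-complete : {x : ℕ} {xs : List ℕ} → x ∈ xs → T (memℕ x xs)
memℕ-complete {x} x∈ = any⁺ (x ≡ᵇ_) (Any.map (λ { refl → ≡⇒≡ᵇ x x refl }) x∈)

eqE-sound : (e e' : Edge) → T (eqE e e') → e ≡ e'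
eqE-sound (a , b) (c , d) h with Equivalence.to T-∧ h
... | a≡c , b≡d = cong₂ _,_ (≡ᵇ⇒≡ a c a≡c) (≡ᵇ⇒≡ b d b≡d)

memE-sound : {e : Edge} {es : List Edge} → T (memE e es) → e ∈ es
memE-sound {e} {es} h = Any.map (λ {e'} → eqE-sound e e') (any⁻ (eqE e) es h)

memE-complete : {e : Edge} {es : List Edge} → e ∈ es → T (memE e es)
memE-complete {a , b} e∈ = any⁺ (eqE (a , b))
  (Any.map (λ { refl → Equivalence.from T-∧ (≡⇒≡ᵇ a a refl , ≡⇒≡ᵇ b b refl) }) e∈)

𝕀 : Bool → ℕ
𝕀 true  = 1
𝕀 false = 0

𝕀-∧ : ∀ a b → 𝕀 (a ∧ b) ≡ 𝕀 a * 𝕀 b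
𝕀-∧ true  b = sym (+-identityʳ (𝕀 b))
𝕀-∧ false b = refl

sumOver : List A → (A → ℕ) → ℕ
sumOver xs f = sum (map f xs)

sumOver-++ : (xs ys : List A) (f : A → ℕ) → sumOver (xs ++ ys) f ≡ sumOver xs f + sumOver ys f
sumOver-++ xs ys f = trans (cong sum (map-++ f xs ys)) (sum-++ (map f xs) (map f ys))

sumOver-cong : (xs : List A) {f g : A → ℕ} → (∀ x → x ∈ xs → f x ≡ g x) → sumOver xs f ≡ sumOver xs g
sumOver-cong []       f≡g = refl
sumOver-cong (x ∷ xs) f≡g = cong₂ _+_ (f≡g x (here refl)) (sumOver-cong xs (λ y y∈ → f≡g y (there y∈)))

sumOver-zero : (xs : List A) (f : A → ℕ) → (∀ x → x ∈ xs → f x ≡ 0) → sumOver xs f ≡ 0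
sumOver-zero xs f f≡0 = trans (sumOver-cong xs f≡0) (zeros xs)
  where
  zeros : (ys : List A) → sumOver ys (λ _ → 0) ≡ 0
  zeros []       = refl
  zeros (_ ∷ ys) = zeros ys

sumOver-+ : (xs : List A) (f g : A → ℕ) → sumOver xs (λ x → f x + g x) ≡ sumOver xs f + sumOver xs g
sumOver-+ []       f g = refl
sumOver-+ (x ∷ xs) f g = begin
  f x + g x + sumOver xs (λ x → f x + g x)   ≡⟨ cong (f x + g x +_) (sumOver-+ xs f g) ⟩
  f x + g x + (sumOver xs f + sumOver xs g)  ≡⟨ +-assoc (f x) (g x) _ ⟩
  f x + (g x + (sumOver xs f + sumOver xs g)) ≡⟨ cong (f x +_) (x∙yz≈y∙xz (g x) (sumOver xs f) _) ⟩
  f x + (sumOver xs f + (g x + sumOver xs g)) ≡⟨ sym (+-assoc (f x) _ _) ⟩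
  f x + sumOver xs f + (g x + sumOver xs g)   ∎
  where
  open ≡-Reasoning

sumOver-*ˡ : (xs : List A) (c : ℕ) (f : A → ℕ) → sumOver xs (λ x → c * f x) ≡ c * sumOver xs f
sumOver-*ˡ []       c f = sym (*-zeroʳ c)
sumOver-*ˡ (x ∷ xs) c f = trans (cong (c * f x +_) (sumOver-*ˡ xs c f)) (sym (*-distribˡ-+ c (f x) _))

length-filter-sum : (p : A → Bool) (xs : List A) → length (filterᵇ p xs) ≡ sumOver xs (𝕀 ∘ p)
length-filter-sum p []       = refl
length-filter-sum p (x ∷ xs) with p x
... | true  = cong suc (length-filter-sum p xs)
... | false = length-filter-sum p xs

sumOver-map : (xs : List A) (g : A → B) (f : B → ℕ) → sumOver (map g xs) f ≡ sumOver xs (f ∘ g)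
sumOver-map xs g f = cong sum (sym (map-∘ xs))

sumOver-swap : (xs : List A) (ys : List B) (f : A → B → ℕ) →
  sumOver xs (λ x → sumOver ys (f x)) ≡ sumOver ys (λ y → sumOver xs (λ x → f x y))
sumOver-swap []       ys f = sym (sumOver-zero ys _ (λ _ _ → refl))
sumOver-swap (x ∷ xs) ys f = trans (cong (sumOver ys (f x) +_) (sumOver-swap xs ys f))
  (sym (sumOver-+ ys (f x) (λ y → sumOver xs (λ x' → f x' y))))

sumOver-cartesian : (xs : List A) (ys : List B) (f : A × B → ℕ) →
  sumOver (cartesianProduct xs ys) f ≡ sumOver xs (λ x → sumOver ys (λ y → f (x , y)))
sumOver-cartesian []       ys f = refl
sumOver-cartesian (x ∷ xs) ys f = trans (sumOver-++ (map (x ,_) ys) _ f)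
  (cong₂ _+_ (sumOver-map ys (x ,_) f) (sumOver-cartesian xs ys f))

sumOver-concatMap : (xs : List A) (h : A → List B) (f : B → ℕ) →
  sumOver (concatMap h xs) f ≡ sumOver xs (λ x → sumOver (h x) f)
sumOver-concatMap []       h f = refl
sumOver-concatMap (x ∷ xs) h f =
  trans (sumOver-++ (h x) (concatMap h xs) f) (cong (sumOver (h x) f +_) (sumOver-concatMap xs h f))

count-sum : (p : List Edge → Bool) (E : List Edge) → count p E ≡ sumOver (subsets E) (𝕀 ∘ p)
count-sum p E = length-filter-sum p (subsets E)

count-cong : (p q : List Edge → Bool) (E : List Edge) → (∀ a → a ∈ subsets E → p a ≡ q a) → count p E ≡ count q E
count-cong p q E p≡q = trans (count-sum p E)
  (trans (sumOver-cong (subsets E) (λ a a∈ → cong 𝕀 (p≡q a a∈))) (sym (count-sum q E)))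

count-none : (p : List Edge → Bool) (E : List Edge) → (∀ a → a ∈ subsets E → p a ≡ false) → count p E ≡ 0
count-none p E p≡false = trans (count-sum p E) (sumOver-zero (subsets E) _ (λ a a∈ → cong 𝕀 (p≡false a a∈)))

-- Subsets of x ∷ E either contain x or not.
count-cons : (p : List Edge → Bool) (x : Edge) (E : List Edge) →
  count p (x ∷ E) ≡ count (λ b → p (x ∷ b)) E + count p E
count-cons p x E = begin
  count p (x ∷ E)                                                       ≡⟨ count-sum p (x ∷ E) ⟩
  sumOver (map (x ∷_) (subsets E) ++ subsets E) (𝕀 ∘ p)                 ≡⟨ sumOver-++ (map (x ∷_) (subsets E)) _ _ ⟩
  sumOver (map (x ∷_) (subsets E)) (𝕀 ∘ p) + sumOver (subsets E) (𝕀 ∘ p) ≡⟨ cong₂ _+_ (sumOver-map (subsets E) (x ∷_) (𝕀 ∘ p)) (sym (count-sum p E)) ⟩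
  sumOver (subsets E) (λ b → 𝕀 (p (x ∷ b))) + count p E                  ≡⟨ cong (_+ count p E) (sym (count-sum _ E)) ⟩
  count (λ b → p (x ∷ b)) E + count p E                                 ∎
  where open ≡-Reasoning

ID-↭ : {a b : List Edge} → a ↭ b → ∀ v → ID a v ≡ ID b v
ID-↭ a↭b v = ↭-length (filter-↭ (T? ∘ λ e → proj₂ e ≡ᵇ v) a↭b)

OD-↭ : {a b : List Edge} → a ↭ b → ∀ v → OD a v ≡ OD b v
OD-↭ a↭b v = ↭-length (filter-↭ (T? ∘ λ e → proj₁ e ≡ᵇ v) a↭b)

ID-++ : (a b : List Edge) (v : ℕ) → ID (a ++ b) v ≡ ID a v + ID b v
ID-++ a b v = trans (cong length (filter-++ (T? ∘ λ e → proj₂ e ≡ᵇ v) a b)) (length-++ (filterᵇ _ a))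

OD-++ : (a b : List Edge) (v : ℕ) → OD (a ++ b) v ≡ OD a v + OD b v
OD-++ a b v = trans (cong length (filter-++ (T? ∘ λ e → proj₁ e ≡ᵇ v) a b)) (length-++ (filterᵇ _ a))

PermInvariant : (List Edge → Bool) → Set
PermInvariant p = ∀ {a b} → a ↭ b → p a ≡ p b

-- Splitting E along a test r: a subset of E is a subset a of its r-part together with a subset b of the rest.
count-split : (p : List Edge → Bool) → PermInvariant p → (r : Edge → Bool) (E : List Edge) →
  count p E ≡ sumOver (subsets (filterᵇ r E)) (λ a → count (λ b → p (a ++ b)) (filterᵇ (not ∘ r) E))
count-split p p-inv r [] = sym (+-identityʳ (count p []))
count-split p p-inv r (x ∷ E) with r x
-- x lies in the r-part: a subset containing x is (x ∷ a) ++ b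
... | true = begin
    count p (x ∷ E)                                       ≡⟨ count-cons p x E ⟩
    count (λ b → p (x ∷ b)) E + count p E                 ≡⟨ cong₂ _+_ (count-split _ (p-inv ∘ prep x) r E) (count-split p p-inv r E) ⟩
    sumOver F (λ a → count (λ b → p (x ∷ a ++ b)) G) + sumOver F (λ a → count (λ b → p (a ++ b)) G)
      ≡⟨ cong (_+ sumOver F _) (sym (sumOver-map F (x ∷_) (λ a → count (λ b → p (a ++ b)) G))) ⟩
    sumOver (map (x ∷_) F) (λ a → count (λ b → p (a ++ b)) G) + sumOver F (λ a → count (λ b → p (a ++ b)) G)
      ≡⟨ sym (sumOver-++ (map (x ∷_) F) F _) ⟩
    sumOver (subsets (x ∷ filterᵇ r E)) (λ a → count (λ b → p (a ++ b)) G) ∎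
  where
  open ≡-Reasoning
  F : List (List Edge)
  F = subsets (filterᵇ r E)
  G : List Edge
  G = filterᵇ (not ∘ r) E
-- x lies in the other part: a subset containing x is a ++ (x ∷ b), up to reordering
... | false = begin
    count p (x ∷ E)                                       ≡⟨ count-cons p x E ⟩
    count (λ b → p (x ∷ b)) E + count p E                 ≡⟨ cong₂ _+_ (count-split _ (p-inv ∘ prep x) r E) (count-split p p-inv r E) ⟩
    sumOver F (λ a → count (λ b → p (x ∷ a ++ b)) G) + sumOver F (λ a → count (λ b → p (a ++ b)) G)
      ≡⟨ cong (_+ sumOver F _) (sumOver-cong F (λ a _ → count-cong _ _ G (λ b _ → p-inv (↭-sym (shift x a b))))) ⟩
    sumOver F (λ a → count (λ b → p (a ++ x ∷ b)) G) + sumOver F (λ a → count (λ b → p (a ++ b)) G)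
      ≡⟨ sym (sumOver-+ F _ _) ⟩
    sumOver F (λ a → count (λ b → p (a ++ x ∷ b)) G + count (λ b → p (a ++ b)) G)
      ≡⟨ sumOver-cong F (λ a _ → sym (count-cons (λ b → p (a ++ b)) x G)) ⟩
    sumOver F (λ a → count (λ b → p (a ++ b)) (x ∷ G)) ∎
  where
  open ≡-Reasoning
  F : List (List Edge)
  F = subsets (filterᵇ r E)
  G : List Edge
  G = filterᵇ (not ∘ r) E

-- The tests counted in T(n) and T_X(n) only look at degrees, so they are invariant under reordering.
isCycleCover-↭ : (n : ℕ) → PermInvariant (isCycleCover n)
isCycleCover-↭ n a↭b = cong and (map-cong (λ v →
  cong₂ (λ x y → (x ≡ᵇ 1) ∧ (y ≡ᵇ 1)) (ID-↭ a↭b v) (OD-↭ a↭b v)) (upTo n))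

legal∧classified-↭ : (S : List ℕ) (n : ℕ) (X : P S) → PermInvariant (λ a → isLegal S n a ∧ classifiedAs S n X a)
legal∧classified-↭ S n (L , R) a↭b = cong₂ _∧_
  (cong and (map-cong (λ v → cong₂ (λ x y → (x ≤ᵇ 1) ∧ (y ≤ᵇ 1) ∧ (memℕ v (Lset S n) ∨ (x ≡ᵇ 1)) ∧ (memℕ v (Rset S n) ∨ (y ≡ᵇ 1)))
                                    (ID-↭ a↭b v) (OD-↭ a↭b v)) (upTo n)))
  (cong and (map-cong (λ i → cong₂ (λ x y → (x ≡ᵇ entry L i) ∧ (y ≡ᵇ entry R i))
                                    (ID-↭ a↭b i) (OD-↭ a↭b (n ∸ 1 ∸ i))) (upTo (sbar S))))

subsets-⊆ : (E : List A) {a : List A} → a ∈ subsets E → ∀ {x} → x ∈ a → x ∈ E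
subsets-⊆ []      (here refl) ()
subsets-⊆ (y ∷ E) a∈ x∈ with ∈-++⁻ (map (y ∷_) (subsets E)) a∈
... | inj₂ a∈E = there (subsets-⊆ E a∈E x∈)
... | inj₁ a∈yE with ∈-map⁻ (y ∷_) a∈yE
...   | a' , a'∈ , refl with x∈
...     | here refl = here refl
...     | there x∈a' = there (subsets-⊆ E a'∈ x∈a')

ID-zero : (a : List Edge) (v : ℕ) → (∀ {e} → e ∈ a → proj₂ e ≢ v) → ID a v ≡ 0
ID-zero a v avoid = cong length (filter-none (T? ∘ λ e → proj₂ e ≡ᵇ v)
  (All.tabulate (λ {e} e∈ t → avoid e∈ (≡ᵇ⇒≡ (proj₂ e) v t))))

OD-zero : (a : List Edge) (v : ℕ) → (∀ {e} → e ∈ a → proj₁ e ≢ v) → OD a v ≡ 0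
OD-zero a v avoid = cong length (filter-none (T? ∘ λ e → proj₁ e ≡ᵇ v)
  (All.tabulate (λ {e} e∈ t → avoid e∈ (≡ᵇ⇒≡ (proj₁ e) v t))))

bit : ℕ → Fin 2
bit zero    = fz
bit (suc _) = fs fz

bit-id : (k : ℕ) → k ≤ 1 → toℕ (bit k) ≡ k
bit-id zero          _          = refl
bit-id (suc zero)    _          = refl
bit-id (suc (suc k)) (s≤s ())

tupleOf : (m : ℕ) → (ℕ → ℕ) → Tup m
tupleOf zero    g = []
tupleOf (suc m) g = bit (g 0) ∷ tupleOf m (g ∘ suc)

entry-tupleOf : (m : ℕ) (g : ℕ → ℕ) {i : ℕ} → i < m → g i ≤ 1 → entry (tupleOf m g) i ≡ g i
entry-tupleOf (suc m) g {zero}  _         g≤1 = bit-id (g 0) g≤1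
entry-tupleOf (suc m) g {suc i} (s≤s i<m) g≤1 = entry-tupleOf m (g ∘ suc) i<m g≤1

matches : (m : ℕ) → Tup m → (ℕ → ℕ) → Bool
matches m w g = all (λ i → g i ≡ᵇ entry w i) (upTo m)

sum-matching-tuple : (m : ℕ) (g : ℕ → ℕ) → (∀ {i} → i < m → g i ≤ 1) → (F : Tup m → ℕ) →
  sumOver (allTup m) (λ w → 𝕀 (matches m w g) * F w) ≡ F (tupleOf m g)
sum-matching-tuple zero    g g≤1 F = trans (+-identityʳ (F [] + 0)) (+-identityʳ (F []))
sum-matching-tuple (suc m) g g≤1 F = begin
    sumOver (allTup (suc m)) (λ w → 𝕀 (matches (suc m) w g) * F w)
      ≡⟨ sumOver-concatMap (allTup m) _ _ ⟩
    sumOver (allTup m) (λ v → term fz v + (term (fs fz) v + 0))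
      ≡⟨ sumOver-cong (allTup m) (λ v _ → select-first-entry v) ⟩
    sumOver (allTup m) (λ v → 𝕀 (matches m v (g ∘ suc)) * F (bit (g 0) ∷ v))
      ≡⟨ sum-matching-tuple m (g ∘ suc) (λ i<m → g≤1 (s≤s i<m)) (λ v → F (bit (g 0) ∷ v)) ⟩
    F (tupleOf (suc m) g) ∎
  where
  open ≡-Reasoning
  term : Fin 2 → Tup m → ℕ
  term b v = 𝕀 (matches (suc m) (b ∷ v) g) * F (b ∷ v)
  -- of the two possible first entries only bit (g 0) can match
  select-bit : (k : ℕ) → k ≤ 1 → (M : Bool) (H : Fin 2 → ℕ) →
    𝕀 ((k ≡ᵇ 0) ∧ M) * H fz + (𝕀 ((k ≡ᵇ 1) ∧ M) * H (fs fz) + 0) ≡ 𝕀 M * H (bit k)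
  select-bit zero       _ M H = +-identityʳ (𝕀 M * H fz)
  select-bit (suc zero) _ M H = +-identityʳ (𝕀 M * H (fs fz))
  select-bit (suc (suc k)) (s≤s ()) M H
  select-first-entry : ∀ v → term fz v + (term (fs fz) v + 0) ≡ 𝕀 (matches m v (g ∘ suc)) * F (bit (g 0) ∷ v)
  select-first-entry v = begin
      term fz v + (term (fs fz) v + 0)
        ≡⟨ cong₂ (λ x y → 𝕀 x * F (fz ∷ v) + (𝕀 y * F (fs fz ∷ v) + 0))
             (all-upTo-suc (λ i → g i ≡ᵇ entry (fz ∷ v) i) m) (all-upTo-suc (λ i → g i ≡ᵇ entry (fs fz ∷ v) i) m) ⟩
      𝕀 ((g 0 ≡ᵇ 0) ∧ matches m v (g ∘ suc)) * F (fz ∷ v) + (𝕀 ((g 0 ≡ᵇ 1) ∧ matches m v (g ∘ suc)) * F (fs fz ∷ v) + 0)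
        ≡⟨ select-bit (g 0) (g≤1 (s≤s z≤n)) (matches m v (g ∘ suc)) (λ b → F (b ∷ v)) ⟩
      𝕀 (matches m v (g ∘ suc)) * F (bit (g 0) ∷ v) ∎

classOf : (S : List ℕ) → ℕ → List Edge → P S
classOf S n a = tupleOf (sbar S) (ID a) , tupleOf (sbar S) (λ i → OD a (n ∸ 1 ∸ i))

sum-classifiedAs : (S : List ℕ) (n : ℕ) (a : List Edge) →
  (∀ {i} → i < sbar S → ID a i ≤ 1) → (∀ {i} → i < sbar S → OD a (n ∸ 1 ∸ i) ≤ 1) → (F : P S → ℕ) →
  sumP S (λ X → 𝕀 (classifiedAs S n X a) * F X) ≡ F (classOf S n a)
sum-classifiedAs S n a in≤1 out≤1 F = begin
    sumP S (λ X → 𝕀 (classifiedAs S n X a) * F X)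
      ≡⟨ sumOver-cartesian (allTup m) (allTup m) _ ⟩
    sumOver (allTup m) (λ L → sumOver (allTup m) (λ R → 𝕀 (classifiedAs S n (L , R) a) * F (L , R)))
      ≡⟨ sumOver-cong (allTup m) (λ L _ → sumOver-cong (allTup m) (λ R _ → split-test L R)) ⟩
    sumOver (allTup m) (λ L → sumOver (allTup m) (λ R → 𝕀 (matches m L (ID a)) * (𝕀 (matches m R out) * F (L , R))))
      ≡⟨ sumOver-cong (allTup m) (λ L _ → sumOver-*ˡ (allTup m) (𝕀 (matches m L (ID a))) _) ⟩
    sumOver (allTup m) (λ L → 𝕀 (matches m L (ID a)) * sumOver (allTup m) (λ R → 𝕀 (matches m R out) * F (L , R)))
      ≡⟨ sumOver-cong (allTup m) (λ L _ → cong (𝕀 (matches m L (ID a)) *_) (sum-matching-tuple m out out≤1 (λ R → F (L , R)))) ⟩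
    sumOver (allTup m) (λ L → 𝕀 (matches m L (ID a)) * F (L , tupleOf m out))
      ≡⟨ sum-matching-tuple m (ID a) in≤1 (λ L → F (L , tupleOf m out)) ⟩
    F (classOf S n a) ∎
  where
  open ≡-Reasoning
  m : ℕ
  m = sbar S
  out : ℕ → ℕ
  out i = OD a (n ∸ 1 ∸ i)
  split-test : ∀ L R → 𝕀 (classifiedAs S n (L , R) a) * F (L , R) ≡ 𝕀 (matches m L (ID a)) * (𝕀 (matches m R out) * F (L , R))
  split-test L R = begin
    𝕀 (classifiedAs S n (L , R) a) * F (L , R)
      ≡⟨ cong (λ b → 𝕀 b * F (L , R)) (all-∧ (λ i → ID a i ≡ᵇ entry L i) (λ i → out i ≡ᵇ entry R i) (upTo m)) ⟩
    𝕀 (matches m L (ID a) ∧ matches m R out) * F (L , R)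
      ≡⟨ cong (_* F (L , R)) (𝕀-∧ (matches m L (ID a)) (matches m R out)) ⟩
    𝕀 (matches m L (ID a)) * 𝕀 (matches m R out) * F (L , R)
      ≡⟨ *-assoc (𝕀 (matches m L (ID a))) _ _ ⟩
    𝕀 (matches m L (ID a)) * (𝕀 (matches m R out) * F (L , R)) ∎

complement : (x y : ℕ) → x + y ≡ 1 → y ≡ 1 ∸ x
complement x y x+y≡1 = trans (sym (m+n∸m≡n x y)) (cong (_∸ x) x+y≡1)

complement⁻¹ : (x y : ℕ) → x ≤ 1 → y ≡ 1 ∸ x → x + y ≡ 1
complement⁻¹ x y x≤1 refl = m+[n∸m]≡n x≤1

mirror<n : {n i : ℕ} → i < n → n ∸ 1 ∸ i < n
mirror<n {suc n} {i} _ = s≤s (m∸n≤m n i)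

mirror-involutive : {n v : ℕ} → v < n → n ∸ 1 ∸ (n ∸ 1 ∸ v) ≡ v
mirror-involutive {suc n} (s≤s v≤n) = m∸[m∸n]≡n v≤n

mirror<s̄ : {n v s̄ : ℕ} → s̄ ≤ n → n ∸ s̄ ≤ v → v < n → n ∸ 1 ∸ v < s̄
mirror<s̄ {n} {v} {s̄} s̄≤n n∸s̄≤v v<n = subst₂ _<_ (sym (∸-+-assoc n 1 v)) (m∸[m∸n]≡n s̄≤n) (∸-monoʳ-< (s≤s n∸s̄≤v) v<n)

split-order : (i j : ℕ) → (∃ λ d → j ≡ i + d) ⊎ (∃ λ k → i ≡ j + suc k)
split-order zero    j       = inj₁ (j , refl)
split-order (suc i) zero    = inj₂ (i , refl)
split-order (suc i) (suc j) with split-order i j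
... | inj₁ (d , j≡i+d) = inj₁ (d , cong suc j≡i+d)
... | inj₂ (k , i≡j+k) = inj₂ (k , cong suc i≡j+k)

diff-offset : (i d : ℕ) → ℤ.+ (i + d) ℤ.- ℤ.+ i ≡ ℤ.+ d
diff-offset i d = trans ([+m]-[+n]≡m⊖n (i + d) i) (trans (⊖-≥ (m≤m+n i d)) (cong ℤ.+_ (m+n∸m≡n i d)))

diff-gap : (j k : ℕ) → ℤ.+ j ℤ.- ℤ.+ (j + suc k) ≡ ℤ.-[1+ k ]
diff-gap j k = trans ([+m]-[+n]≡m⊖n j (j + suc k))
  (trans (⊖-< (m<m+n j {suc k} z<s)) (cong (λ z → ℤ.- (ℤ.+ z)) (m+n∸m≡n j (suc k))))

≟-sound : {x y : ℤ.ℤ} → T (does (x ℤ.≟ y)) → x ≡ y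
≟-sound {x} {y} h with x ℤ.≟ y
... | yes x≡y = x≡y

≟-complete : {x y : ℤ.ℤ} → x ≡ y → T (does (x ℤ.≟ y))
≟-complete {x} {y} x≡y with x ℤ.≟ y
... | yes _  = tt
... | no x≢y = x≢y x≡y

isL-sound : (S : List ℕ) {i j : ℕ} → T (isL S (i , j)) → ∃ λ s → s ∈ S × j ≡ i + s
isL-sound S {i} {j} h with find (any⁻ _ (map ℤ.+_ S) h)
... | y , y∈ , diff≡y with ∈-map⁻ ℤ.+_ y∈
... | s , s∈ , refl with split-order i j
... | inj₁ (d , refl) = s , s∈ , cong (i +_) (ℤ+-injective (trans (sym (diff-offset i d)) (≟-sound diff≡y)))
... | inj₂ (k , refl) with () ← trans (sym (diff-gap j k)) (≟-sound diff≡y)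

isL-complete : (S : List ℕ) (i : ℕ) {s : ℕ} → s ∈ S → T (isL S (i , i + s))
isL-complete S i s∈ = any⁺ _ (map⁺ (Any.map (λ { refl → ≟-complete (diff-offset i _) }) s∈))

modN-below : (d n : ℕ) → d < n → modN (ℤ.+ d) n ≡ d
modN-below d (suc n) d<n = m<n⇒m%n≡m d<n

modN-negative : (k n : ℕ) → suc k < n → modN ℤ.-[1+ k ] n ≡ n ∸ suc k
modN-negative k (suc n) k<n rewrite m<n⇒m%n≡m k<n = refl

isC-forward : (S : List ℕ) (n i d : ℕ) → i + d < n → isC S n (i , i + d) ≡ memℕ d S
isC-forward S n i d i+d<n =
  trans (cong (λ z → memℕ (modN z n) S) (diff-offset i d))
        (cong (λ z → memℕ z S) (modN-below d n (≤-<-trans (m≤n+m d i) i+d<n)))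

isC-backward : (S : List ℕ) (n j k : ℕ) → j + suc k < n → isC S n (j + suc k , j) ≡ memℕ (n ∸ suc k) S
isC-backward S n j k j+k<n =
  trans (cong (λ z → memℕ (modN z n) S) (diff-gap j k))
        (cong (λ z → memℕ z S) (modN-negative k n (≤-<-trans (m≤n+m (suc k) j) j+k<n)))

filter-filter : (p q : A → Bool) (xs : List A) → filterᵇ q (filterᵇ p xs) ≡ filterᵇ (λ x → p x ∧ q x) xs
filter-filter p q []       = refl
filter-filter p q (x ∷ xs) with p x
... | false = filter-filter p q xs
... | true with q x
...   | true  = cong (x ∷_) (filter-filter p q xs)
...   | false = filter-filter p q xs

filter-cong-∈ : (p q : A → Bool) (xs : List A) → (∀ {x} → x ∈ xs → p x ≡ q x) → filterᵇ p xs ≡ filterᵇ q xs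
filter-cong-∈ p q []       p≡q = refl
filter-cong-∈ p q (x ∷ xs) p≡q with p x | q x | p≡q (here refl)
... | true  | true  | _ = cong (x ∷_) (filter-cong-∈ p q xs (p≡q ∘ there))
... | false | false | _ = filter-cong-∈ p q xs (p≡q ∘ there)

filter-map : (r : B → Bool) (f : A → B) (xs : List A) → filterᵇ r (map f xs) ≡ map f (filterᵇ (r ∘ f) xs)
filter-map r f []       = refl
filter-map r f (x ∷ xs) with r (f x)
... | true  = cong (f x ∷_) (filter-map r f xs)
... | false = filter-map r f xs

filter-false : (xs : List A) → filterᵇ (λ _ → false) xs ≡ []
filter-false []       = refl
filter-false (_ ∷ xs) = filter-false xs

filter-cartesian : {A B : Set} (p : A → Bool) (q : B → Bool) (xs : List A) (ys : List B) →
  filterᵇ (λ e → p (proj₁ e) ∧ q (proj₂ e)) (cartesianProduct xs ys) ≡ cartesianProduct (filterᵇ p xs) (filterᵇ q ys)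
filter-cartesian p q []       ys = refl
filter-cartesian {A} {B} p q (x ∷ xs) ys = begin
    filterᵇ r (map (x ,_) ys ++ cartesianProduct xs ys)
      ≡⟨ filter-++ (T? ∘ r) (map (x ,_) ys) (cartesianProduct xs ys) ⟩
    filterᵇ r (map (x ,_) ys) ++ filterᵇ r (cartesianProduct xs ys)
      ≡⟨ cong₂ _++_ (filter-map r (x ,_) ys) (filter-cartesian p q xs ys) ⟩
    map (x ,_) (filterᵇ (λ y → p x ∧ q y) ys) ++ rest
      ≡⟨ first-row ⟩
    cartesianProduct (filterᵇ p (x ∷ xs)) (filterᵇ q ys) ∎
  where
  open ≡-Reasoning
  r : A × B → Bool
  r e = p (proj₁ e) ∧ q (proj₂ e)
  rest : List (A × B)
  rest = cartesianProduct (filterᵇ p xs) (filterᵇ q ys)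
  first-row : map (x ,_) (filterᵇ (λ y → p x ∧ q y) ys) ++ rest ≡ cartesianProduct (filterᵇ p (x ∷ xs)) (filterᵇ q ys)
  first-row with p x
  ... | true  = refl
  ... | false = cong (λ zs → map (x ,_) zs ++ rest) (filter-false ys)

∈pairs⁻ : {n i j : ℕ} → (i , j) ∈ pairs n → i < n × j < n
∈pairs⁻ {n} ij∈ with ∈-cartesianProduct⁻ (upTo n) (upTo n) ij∈
... | i∈ , j∈ = ∈-upTo⁻ i∈ , ∈-upTo⁻ j∈

∈pairs⁺ : {n i j : ℕ} → i < n → j < n → (i , j) ∈ pairs n
∈pairs⁺ i<n j<n = ∈-cartesianProduct⁺ (∈-upTo⁺ i<n) (∈-upTo⁺ j<n)

inRange : ℕ → Edge → Bool
inRange n (i , j) = (i <ᵇ n) ∧ (j <ᵇ n)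

upTo-restrict : (n : ℕ) → filterᵇ (_<ᵇ n) (upTo (suc n)) ≡ upTo n
upTo-restrict n = begin
    filterᵇ (_<ᵇ n) (upTo (suc n))                     ≡⟨ cong (filterᵇ (_<ᵇ n)) (sym (upTo-∷ʳ n)) ⟩
    filterᵇ (_<ᵇ n) (upTo n ++ n ∷ [])                  ≡⟨ filter-++ (T? ∘ (_<ᵇ n)) (upTo n) (n ∷ []) ⟩
    filterᵇ (_<ᵇ n) (upTo n) ++ filterᵇ (_<ᵇ n) (n ∷ []) ≡⟨ cong₂ _++_ below-kept n-dropped ⟩
    upTo n ++ []                                       ≡⟨ ++-identityʳ (upTo n) ⟩
    upTo n                                             ∎
  where
  open ≡-Reasoning
  below-kept : filterᵇ (_<ᵇ n) (upTo n) ≡ upTo n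
  below-kept = filter-all (T? ∘ (_<ᵇ n)) (All.tabulate (λ i∈ → <⇒<ᵇ (∈-upTo⁻ i∈)))
  n-dropped : filterᵇ (_<ᵇ n) (n ∷ []) ≡ []
  n-dropped = filter-none (T? ∘ (_<ᵇ n)) ((λ n<n → <-irrefl refl (<ᵇ⇒< n n n<n)) All.∷ All.[])

pairs-restrict : (n : ℕ) → filterᵇ (inRange n) (pairs (suc n)) ≡ pairs n
pairs-restrict n = trans (filter-cartesian (_<ᵇ n) (_<ᵇ n) (upTo (suc n)) (upTo (suc n)))
                         (cong₂ cartesianProduct (upTo-restrict n) (upTo-restrict n))

module EdgeSets (S : List ℕ) (S≤s̄ : ∀ {s} → s ∈ S → s ≤ sbar S) where

  s̄ : ℕ
  s̄ = sbar S

  ∈EL⁻ : {n i j : ℕ} → (i , j) ∈ EL S n → (i < n × j < n) × (∃ λ s → s ∈ S × j ≡ i + s)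
  ∈EL⁻ e∈ with ∈-filter⁻ (T? ∘ isL S) e∈
  ... | e∈pairs , e-isL = ∈pairs⁻ e∈pairs , isL-sound S e-isL

  ∈EL⁺ : {n i j : ℕ} → i < n → j < n → T (isL S (i , j)) → (i , j) ∈ EL S n
  ∈EL⁺ i<n j<n e-isL = ∈-filter⁺ (T? ∘ isL S) (∈pairs⁺ i<n j<n) e-isL

  Hook-edge : {n i j : ℕ} → (i , j) ∈ Hook S n → n ∸ s̄ ≤ i × j < s̄
  Hook-edge {n} {i} {j} e∈ with ∈-filter⁻ (T? ∘ λ e → not (memE e (EL S n))) {xs = EC S n} e∈
  ... | e∈EC , e∉EL with ∈-filter⁻ (T? ∘ isC S n) {xs = pairs n} e∈EC
  ... | e∈pairs , e-isC with ∈pairs⁻ {n} e∈pairs | split-order i j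
  ... | i<n , j<n | inj₁ (d , refl) =
    ⊥-elim (T-not⇒¬T e∉EL (memE-complete (∈EL⁺ {n} i<n j<n (isL-complete S i d∈S))))
    where
    d∈S : d ∈ S
    d∈S = memℕ-sound (subst T (isC-forward S n i d j<n) e-isC)
  ... | i<n , j<n | inj₂ (k , refl) = ≤-trans n∸s̄≤k+1 (m≤n+m (suc k) j) , j<s̄
    where
    k+1≤n : suc k ≤ n
    k+1≤n = ≤-trans (m≤n+m (suc k) j) (<⇒≤ i<n)
    n≤s̄+k+1 : n ≤ s̄ + suc k
    n≤s̄+k+1 = subst (_≤ s̄ + suc k) (m∸n+n≡m k+1≤n)
                 (+-monoˡ-≤ (suc k) (S≤s̄ (memℕ-sound (subst T (isC-backward S n j k i<n) e-isC))))
    n∸s̄≤k+1 : n ∸ s̄ ≤ suc k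
    n∸s̄≤k+1 = subst (n ∸ s̄ ≤_) (m+n∸m≡n s̄ (suc k)) (∸-monoˡ-≤ s̄ n≤s̄+k+1)
    j<s̄ : j < s̄
    j<s̄ = +-cancelʳ-< (suc k) j s̄ (<-≤-trans i<n n≤s̄+k+1)

  New-edge : {n i j : ℕ} → (i , j) ∈ New S n → j ≡ n × n ∸ s̄ ≤ i
  New-edge {n} {i} {j} e∈ with ∈-filter⁻ (T? ∘ λ e → not (memE e (EL S n))) {xs = EL S (suc n)} e∈
  ... | e∈EL' , e∉EL with ∈EL⁻ {suc n} e∈EL'
  ... | (s≤s i≤n , s≤s j≤n) , (s , s∈ , refl) with i + s <? n
  ... | yes j<n = ⊥-elim (T-not⇒¬T e∉EL (memE-complete (∈EL⁺ {n} (≤-<-trans (m≤m+n i s) j<n) j<n (isL-complete S i s∈))))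
  ... | no  j≮n = j≡n , subst (λ z → z ∸ s̄ ≤ i) j≡n (≤-trans (∸-monoʳ-≤ (i + s) (S≤s̄ s∈)) (≤-reflexive (m+n∸n≡m i s)))
    where
    j≡n : i + s ≡ n
    j≡n = ≤-antisym j≤n (≮⇒≥ j≮n)

  EC-restrict : (n : ℕ) → filterᵇ (λ e → memE e (EL S n)) (EC S n) ≡ EL S n
  EC-restrict n = trans (filter-filter (isC S n) (λ e → memE e (EL S n)) (pairs n))
                        (filter-cong-∈ _ (isL S) (pairs n) agree)
    where
    agree : ∀ {e} → e ∈ pairs n → (isC S n e ∧ memE e (EL S n)) ≡ isL S e
    agree {i , j} e∈ = T-ext in-EL⇒isL isL⇒in-EL
      where
      in-EL⇒isL : T (isC S n (i , j) ∧ memE (i , j) (EL S n)) → T (isL S (i , j))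
      in-EL⇒isL t = proj₂ (∈-filter⁻ (T? ∘ isL S) {xs = pairs n} (memE-sound {i , j} {EL S n} (proj₂ (Equivalence.to (T-∧ {isC S n (i , j)}) t))))
      isL⇒in-EL : T (isL S (i , j)) → T (isC S n (i , j) ∧ memE (i , j) (EL S n))
      isL⇒in-EL t with isL-sound S {i} {j} t | ∈pairs⁻ {n} e∈
      ... | s , s∈ , refl | i<n , j<n = Equivalence.from (T-∧ {isC S n (i , i + s)})
        (subst T (sym (isC-forward S n i s j<n)) (memℕ-complete s∈) , memE-complete {i , i + s} {EL S n} (∈EL⁺ {n} i<n j<n t))

  EL-restrict : (n : ℕ) → filterᵇ (λ e → memE e (EL S n)) (EL S (suc n)) ≡ EL S n
  EL-restrict n = begin
      filterᵇ inEL (filterᵇ (isL S) (pairs (suc n)))      ≡⟨ filter-filter (isL S) inEL (pairs (suc n)) ⟩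
      filterᵇ (λ e → isL S e ∧ inEL e) (pairs (suc n))    ≡⟨ filter-cong-∈ _ _ (pairs (suc n)) (λ {e} _ → agree e) ⟩
      filterᵇ (λ e → inRange n e ∧ isL S e) (pairs (suc n)) ≡⟨ sym (filter-filter (inRange n) (isL S) (pairs (suc n))) ⟩
      filterᵇ (isL S) (filterᵇ (inRange n) (pairs (suc n))) ≡⟨ cong (filterᵇ (isL S)) (pairs-restrict n) ⟩
      EL S n                                              ∎
    where
    open ≡-Reasoning
    inEL : Edge → Bool
    inEL e = memE e (EL S n)
    agree : (e : Edge) → (isL S e ∧ inEL e) ≡ (inRange n e ∧ isL S e)
    agree (i , j) = T-ext
      (λ t → let e-isL , e∈ = Equivalence.to (T-∧ {isL S (i , j)}) t
                 (i<n , j<n) , _ = ∈EL⁻ {n} (memE-sound {i , j} {EL S n} e∈)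
             in Equivalence.from (T-∧ {inRange n (i , j)}) (Equivalence.from (T-∧ {i <ᵇ n}) (<⇒<ᵇ i<n , <⇒<ᵇ j<n) , e-isL))
      (λ t → let range , e-isL = Equivalence.to (T-∧ {inRange n (i , j)}) t
                 i<n , j<n = Equivalence.to (T-∧ {i <ᵇ n}) range
             in Equivalence.from (T-∧ {isL S (i , j)}) (e-isL , memE-complete (∈EL⁺ {n} (<ᵇ⇒< i n i<n) (<ᵇ⇒< j n j<n) e-isL)))

CycleCover : ℕ → List Edge → Set
CycleCover n a = ∀ {v} → v < n → ID a v ≡ 1 × OD a v ≡ 1

cover-sound : (n : ℕ) (a : List Edge) → T (isCycleCover n a) → CycleCover n a
cover-sound n a = all-eqs⁻ (ID a) (λ _ → 1) (OD a) (λ _ → 1) n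

cover-complete : (n : ℕ) (a : List Edge) → CycleCover n a → T (isCycleCover n a)
cover-complete n a = all-eqs⁺ (ID a) (λ _ → 1) (OD a) (λ _ → 1) n

∈Lset⁻ : (S : List ℕ) (n v : ℕ) → T (memℕ v (Lset S n)) → v < sbar S
∈Lset⁻ S n v t = ∈-upTo⁻ (memℕ-sound t)

∈Lset⁺ : (S : List ℕ) (n v : ℕ) → v < sbar S → T (memℕ v (Lset S n))
∈Lset⁺ S n v v<s̄ = memℕ-complete (∈-upTo⁺ v<s̄)

∈Rset⁻ : (S : List ℕ) (n v : ℕ) → sbar S ≤ n → T (memℕ v (Rset S n)) → n ∸ sbar S ≤ v × v < n
∈Rset⁻ S n v s̄≤n t with ∈-map⁻ (λ i → (n ∸ sbar S) + i) {xs = upTo (sbar S)} (memℕ-sound {v} {Rset S n} t)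
... | i , i∈ , refl = m≤m+n (n ∸ sbar S) i ,
  subst (n ∸ sbar S + i <_) (m∸n+n≡m s̄≤n) (+-monoʳ-< (n ∸ sbar S) (∈-upTo⁻ i∈))

∈Rset⁺ : (S : List ℕ) (n v : ℕ) → sbar S ≤ n → n ∸ sbar S ≤ v → v < n → T (memℕ v (Rset S n))
∈Rset⁺ S n v s̄≤n n∸s̄≤v v<n =
  memℕ-complete (subst (_∈ Rset S n) (m+[n∸m]≡n n∸s̄≤v) (∈-map⁺ (λ i → (n ∸ sbar S) + i) (∈-upTo⁺ offset<s̄)))
  where
  offset<s̄ : v ∸ (n ∸ sbar S) < sbar S
  offset<s̄ = +-cancelˡ-< (n ∸ sbar S) (v ∸ (n ∸ sbar S)) (sbar S)
    (subst (_< n ∸ sbar S + sbar S) (sym (m+[n∸m]≡n n∸s̄≤v)) (subst (v <_) (sym (m∸n+n≡m s̄≤n)) v<n))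

record Legal (S : List ℕ) (n : ℕ) (a : List Edge) : Set where
  field
    in≤1  : ∀ {v} → v < n → ID a v ≤ 1
    out≤1 : ∀ {v} → v < n → OD a v ≤ 1
    in≡1  : ∀ {v} → v < n → sbar S ≤ v → ID a v ≡ 1
    out≡1 : ∀ {v} → v < n ∸ sbar S → OD a v ≡ 1

legalAt : List ℕ → ℕ → List Edge → ℕ → Bool
legalAt S n a v = (ID a v ≤ᵇ 1) ∧ (OD a v ≤ᵇ 1) ∧ (memℕ v (Lset S n) ∨ (ID a v ≡ᵇ 1)) ∧ (memℕ v (Rset S n) ∨ (OD a v ≡ᵇ 1))

-- For s̄ ≤ n (so that R(n) consists of the last s̄ vertices) isLegal decides Legal.
module _ (S : List ℕ) (n : ℕ) (s̄≤n : sbar S ≤ n) where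

  legal-sound : (a : List Edge) → T (isLegal S n a) → Legal S n a
  legal-sound a t = record
    { in≤1  = λ v<n → proj₁ (at v<n)
    ; out≤1 = λ v<n → proj₁ (proj₂ (at v<n))
    ; in≡1  = λ v<n → proj₁ (proj₂ (proj₂ (at v<n)))
    ; out≡1 = λ v<n∸s̄ → proj₂ (proj₂ (proj₂ (at (<-≤-trans v<n∸s̄ (m∸n≤m n (sbar S)))))) v<n∸s̄
    }
    where
    at : ∀ {v} → v < n →
      ID a v ≤ 1 × OD a v ≤ 1 × (sbar S ≤ v → ID a v ≡ 1) × (v < n ∸ sbar S → OD a v ≡ 1)
    at {v} v<n with Equivalence.to (T-∧ {ID a v ≤ᵇ 1}) (all-upTo⁻ (legalAt S n a) n t v<n)
    ... | in≤1 , t₁ with Equivalence.to (T-∧ {OD a v ≤ᵇ 1}) t₁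
    ... | out≤1 , t₂ with Equivalence.to (T-∧ {memℕ v (Lset S n) ∨ (ID a v ≡ᵇ 1)}) t₂
    ... | inL , outR = ≤ᵇ⇒≤ _ 1 in≤1 , ≤ᵇ⇒≤ _ 1 out≤1 ,
                       in≡1 (Equivalence.to T-∨ inL) , out≡1 (Equivalence.to T-∨ outR)
      where
      in≡1 : T (memℕ v (Lset S n)) ⊎ T (ID a v ≡ᵇ 1) → sbar S ≤ v → ID a v ≡ 1
      in≡1 (inj₁ v∈L) s̄≤v = ⊥-elim (<⇒≱ (∈Lset⁻ S n v v∈L) s̄≤v)
      in≡1 (inj₂ t)   _   = ≡ᵇ⇒≡ _ 1 t
      out≡1 : T (memℕ v (Rset S n)) ⊎ T (OD a v ≡ᵇ 1) → v < n ∸ sbar S → OD a v ≡ 1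
      out≡1 (inj₁ v∈R) v<n∸s̄ = ⊥-elim (<⇒≱ v<n∸s̄ (proj₁ (∈Rset⁻ S n v s̄≤n v∈R)))
      out≡1 (inj₂ t)   _     = ≡ᵇ⇒≡ _ 1 t

  legal-complete : (a : List Edge) → Legal S n a → T (isLegal S n a)
  legal-complete a legal = all-upTo⁺ (legalAt S n a) n at
    where
    open Legal legal
    at : ∀ {v} → v < n → T (legalAt S n a v)
    at {v} v<n = Equivalence.from T-∧ (≤⇒≤ᵇ (in≤1 v<n) , Equivalence.from T-∧ (≤⇒≤ᵇ (out≤1 v<n) ,
                   Equivalence.from T-∧ (inL , outR)))
      where
      inL : T (memℕ v (Lset S n) ∨ (ID a v ≡ᵇ 1))
      inL with v <? sbar S
      ... | yes v<s̄ = Equivalence.from T-∨ (inj₁ (∈Lset⁺ S n v v<s̄))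
      ... | no  v≮s̄ = Equivalence.from T-∨ (inj₂ (≡⇒≡ᵇ _ 1 (in≡1 v<n (≮⇒≥ v≮s̄))))
      outR : T (memℕ v (Rset S n) ∨ (OD a v ≡ᵇ 1))
      outR with v <? n ∸ sbar S
      ... | yes v<n∸s̄ = Equivalence.from T-∨ (inj₂ (≡⇒≡ᵇ _ 1 (out≡1 v<n∸s̄)))
      ... | no  v≮n∸s̄ = Equivalence.from T-∨ (inj₁ (∈Rset⁺ S n v s̄≤n (≮⇒≥ v≮n∸s̄) v<n))

sum-by-classification : (S : List ℕ) (n : ℕ) → sbar S ≤ n → (G : P S → ℕ) →
  sumP S (λ X → G X * TX S n X) ≡ sumOver (subsets (EL S n)) (λ a → 𝕀 (isLegal S n a) * G (classOf S n a))
sum-by-classification S n s̄≤n G = begin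
    sumP S (λ X → G X * TX S n X)
      ≡⟨ sumOver-cong (allP S) (λ X _ → cong (G X *_) (count-sum _ (EL S n))) ⟩
    sumP S (λ X → G X * sumOver E (λ a → 𝕀 (legal∧class X a)))
      ≡⟨ sumOver-cong (allP S) (λ X _ → sym (sumOver-*ˡ E (G X) _)) ⟩
    sumP S (λ X → sumOver E (λ a → G X * 𝕀 (legal∧class X a)))
      ≡⟨ sumOver-swap (allP S) E _ ⟩
    sumOver E (λ a → sumP S (λ X → G X * 𝕀 (legal∧class X a)))
      ≡⟨ sumOver-cong E (λ a _ → trans (sumOver-cong (allP S) (λ X _ → *-comm (G X) _)) (select a)) ⟩
    sumOver E (λ a → 𝕀 (isLegal S n a) * G (classOf S n a)) ∎
  where
  open ≡-Reasoning
  E : List (List Edge)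
  E = subsets (EL S n)
  legal∧class : P S → List Edge → Bool
  legal∧class X a = isLegal S n a ∧ classifiedAs S n X a
  select : (a : List Edge) → sumP S (λ X → 𝕀 (legal∧class X a) * G X) ≡ 𝕀 (isLegal S n a) * G (classOf S n a)
  select a with isLegal S n a in legal≡
  ... | false = sumOver-zero (allP S) _ (λ _ _ → refl)
  ... | true  = trans (sum-classifiedAs S n a (λ i<s̄ → in≤1 (<-≤-trans i<s̄ s̄≤n))
                                              (λ i<s̄ → out≤1 (mirror<n (<-≤-trans i<s̄ s̄≤n))) G)
                      (sym (+-identityʳ _))
    where open Legal (legal-sound S n s̄≤n a (Equivalence.from T-≡ legal≡))

module _ {S : List ℕ} {n : ℕ} {a : List Edge} (s̄≤n : sbar S ≤ n) (legal : Legal S n a) where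
  open Legal legal

  classOf-in : ∀ {i} → i < sbar S → entry (proj₁ (classOf S n a)) i ≡ ID a i
  classOf-in i<s̄ = entry-tupleOf (sbar S) (ID a) i<s̄ (in≤1 (<-≤-trans i<s̄ s̄≤n))

  classOf-out : ∀ {i} → i < sbar S → entry (proj₂ (classOf S n a)) i ≡ OD a (n ∸ 1 ∸ i)
  classOf-out i<s̄ = entry-tupleOf (sbar S) (λ i → OD a (n ∸ 1 ∸ i)) i<s̄ (out≤1 (mirror<n (<-≤-trans i<s̄ s̄≤n)))

hookTest : (S : List ℕ) → ℕ → P S → List Edge → Bool
hookTest S n (L , R) b = all (λ i → (ID b i ≡ᵇ (1 ∸ entry L i)) ∧ (OD b (n ∸ 1 ∸ i) ≡ᵇ (1 ∸ entry R i))) (upTo (sbar S))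

module HookCompletion (S : List ℕ) (S≤s̄ : ∀ {s} → s ∈ S → s ≤ sbar S) (n : ℕ) (s̄≤n : sbar S ≤ n) where
  open EdgeSets S S≤s̄

  hooks-in-zero : {b : List Edge} → b ∈ subsets (Hook S n) → ∀ {v} → s̄ ≤ v → ID b v ≡ 0
  hooks-in-zero {b} b∈ {v} s̄≤v = ID-zero b v (λ { {i , j} e∈ refl →
    <⇒≱ (proj₂ (Hook-edge {n} (subsets-⊆ (Hook S n) b∈ e∈))) s̄≤v })

  hooks-out-zero : {b : List Edge} → b ∈ subsets (Hook S n) → ∀ {v} → v < n ∸ s̄ → OD b v ≡ 0
  hooks-out-zero {b} b∈ {v} v<n∸s̄ = OD-zero b v (λ { {i , j} e∈ refl →
    <⇒≱ v<n∸s̄ (proj₁ (Hook-edge {n} (subsets-⊆ (Hook S n) b∈ e∈))) })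

  cover⇒legal : {a b : List Edge} → b ∈ subsets (Hook S n) → CycleCover n (a ++ b) → Legal S n a
  cover⇒legal {a} {b} b∈ cover = record
    { in≤1  = λ {v} v<n → subst (ID a v ≤_) (in-one v<n) (m≤m+n (ID a v) (ID b v))
    ; out≤1 = λ {v} v<n → subst (OD a v ≤_) (out-one v<n) (m≤m+n (OD a v) (OD b v))
    ; in≡1  = λ {v} v<n s̄≤v → trans (sym (+-identityʳ (ID a v))) (trans (cong (ID a v +_) (sym (hooks-in-zero b∈ s̄≤v))) (in-one v<n))
    ; out≡1 = λ {v} v<n∸s̄ → trans (sym (+-identityʳ (OD a v)))
                (trans (cong (OD a v +_) (sym (hooks-out-zero b∈ v<n∸s̄))) (out-one (<-≤-trans v<n∸s̄ (m∸n≤m n s̄))))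
    }
    where
    in-one : ∀ {v} → v < n → ID a v + ID b v ≡ 1
    in-one {v} v<n = trans (sym (ID-++ a b v)) (proj₁ (cover v<n))
    out-one : ∀ {v} → v < n → OD a v + OD b v ≡ 1
    out-one {v} v<n = trans (sym (OD-++ a b v)) (proj₂ (cover v<n))

  cover⇔hookTest : {a b : List Edge} → b ∈ subsets (Hook S n) → Legal S n a →
    isCycleCover n (a ++ b) ≡ hookTest S n (classOf S n a) b
  cover⇔hookTest {a} {b} b∈ legal = T-ext cover⇒test test⇒cover
    where
    open Legal legal
    L' R' : Tup s̄
    L' = proj₁ (classOf S n a)
    R' = proj₂ (classOf S n a)
    cover⇒test : T (isCycleCover n (a ++ b)) → T (hookTest S n (classOf S n a) b)
    cover⇒test t = all-eqs⁺ (ID b) (λ i → 1 ∸ entry L' i) (λ i → OD b (n ∸ 1 ∸ i)) (λ i → 1 ∸ entry R' i) s̄ (λ {i} i<s̄ →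
      let i<n = <-≤-trans i<s̄ s̄≤n
          i' = n ∸ 1 ∸ i
      in trans (complement (ID a i) (ID b i) (trans (sym (ID-++ a b i)) (proj₁ (cover-sound n (a ++ b) t i<n))))
               (cong (1 ∸_) (sym (classOf-in s̄≤n legal i<s̄))) ,
         trans (complement (OD a i') (OD b i') (trans (sym (OD-++ a b i')) (proj₂ (cover-sound n (a ++ b) t (mirror<n i<n)))))
               (cong (1 ∸_) (sym (classOf-out s̄≤n legal i<s̄))))
    test⇒cover : T (hookTest S n (classOf S n a) b) → T (isCycleCover n (a ++ b))
    test⇒cover t = cover-complete n (a ++ b) (λ {v} v<n → trans (ID-++ a b v) (in-one v<n) , trans (OD-++ a b v) (out-one v<n))
      where
      test : ∀ {i} → i < s̄ → ID b i ≡ 1 ∸ entry L' i × OD b (n ∸ 1 ∸ i) ≡ 1 ∸ entry R' i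
      test = all-eqs⁻ (ID b) (λ i → 1 ∸ entry L' i) (λ i → OD b (n ∸ 1 ∸ i)) (λ i → 1 ∸ entry R' i) s̄ t
      in-one : ∀ {v} → v < n → ID a v + ID b v ≡ 1
      in-one {v} v<n with v <? s̄
      ... | yes v<s̄ = complement⁻¹ (ID a v) (ID b v) (in≤1 v<n) (trans (proj₁ (test v<s̄)) (cong (1 ∸_) (classOf-in s̄≤n legal v<s̄)))
      ... | no  v≮s̄ = cong₂ _+_ (in≡1 v<n (≮⇒≥ v≮s̄)) (hooks-in-zero b∈ (≮⇒≥ v≮s̄))
      out-one : ∀ {v} → v < n → OD a v + OD b v ≡ 1
      out-one {v} v<n with v <? n ∸ s̄
      ... | yes v<n∸s̄ = cong₂ _+_ (out≡1 v<n∸s̄) (hooks-out-zero b∈ v<n∸s̄)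
      ... | no  v≮n∸s̄ = complement⁻¹ (OD a v) (OD b v) (out≤1 v<n)
            (subst (λ w → OD b w ≡ 1 ∸ OD a w) (mirror-involutive v<n)
              (trans (proj₂ (test i<s̄)) (cong (1 ∸_) (classOf-out s̄≤n legal i<s̄))))
        where
        i<s̄ : n ∸ 1 ∸ v < s̄
        i<s̄ = mirror<s̄ s̄≤n (≮⇒≥ v≮n∸s̄) v<n

  hook-completions : (a : List Edge) →
    count (λ b → isCycleCover n (a ++ b)) (Hook S n) ≡ 𝕀 (isLegal S n a) * β S n (classOf S n a)
  hook-completions a with isLegal S n a in legal≡
  ... | false = count-none _ (Hook S n) (λ b b∈ → ¬T⇒≡false (λ t →
                  subst T legal≡ (legal-complete S n s̄≤n a (cover⇒legal b∈ (cover-sound n (a ++ b) t)))))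
  ... | true  = trans (count-cong _ _ (Hook S n) (λ b b∈ → cover⇔hookTest b∈ legal)) (sym (+-identityʳ _))
    where
    legal : Legal S n a
    legal = legal-sound S n s̄≤n a (Equivalence.from T-≡ legal≡)

module NewCompletion (S : List ℕ) (S≤s̄ : ∀ {s} → s ∈ S → s ≤ sbar S) (n : ℕ) (s̄≤n : sbar S ≤ n) where
  open EdgeSets S S≤s̄

  s̄≤n+1 : s̄ ≤ suc n
  s̄≤n+1 = ≤-trans s̄≤n (n≤1+n n)

  n+1∸s̄ : suc n ∸ s̄ ≡ suc (n ∸ s̄)
  n+1∸s̄ = +-∸-assoc 1 s̄≤n

  old-in-zero : {a : List Edge} → a ∈ subsets (EL S n) → ID a n ≡ 0
  old-in-zero {a} a∈ = ID-zero a n (λ { {i , j} e∈ refl → <-irrefl refl (proj₂ (proj₁ (∈EL⁻ {n} (subsets-⊆ (EL S n) a∈ e∈)))) })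

  old-out-zero : {a : List Edge} → a ∈ subsets (EL S n) → OD a n ≡ 0
  old-out-zero {a} a∈ = OD-zero a n (λ { {i , j} e∈ refl → <-irrefl refl (proj₁ (proj₁ (∈EL⁻ {n} (subsets-⊆ (EL S n) a∈ e∈)))) })

  new-in-zero : {b : List Edge} → b ∈ subsets (New S n) → ∀ {v} → v < n → ID b v ≡ 0
  new-in-zero {b} b∈ {v} v<n = ID-zero b v (λ { {i , j} e∈ refl →
    <-irrefl (proj₁ (New-edge {n} (subsets-⊆ (New S n) b∈ e∈))) v<n })

  new-out-zero : {b : List Edge} → b ∈ subsets (New S n) → ∀ {v} → v < n ∸ s̄ → OD b v ≡ 0
  new-out-zero {b} b∈ {v} v<n∸s̄ = OD-zero b v (λ { {i , j} e∈ refl →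
    <⇒≱ v<n∸s̄ (proj₂ (New-edge {n} (subsets-⊆ (New S n) b∈ e∈))) })

  module _ {a b : List Edge} (a∈ : a ∈ subsets (EL S n)) (b∈ : b ∈ subsets (New S n)) where

    ID-old : ∀ {v} → v < n → ID (a ++ b) v ≡ ID a v
    ID-old {v} v<n = trans (ID-++ a b v) (trans (cong (ID a v +_) (new-in-zero b∈ v<n)) (+-identityʳ (ID a v)))

    ID-new : ID (a ++ b) n ≡ ID b n
    ID-new = trans (ID-++ a b n) (cong (_+ ID b n) (old-in-zero a∈))

    OD-old : ∀ {v} → v < n ∸ s̄ → OD (a ++ b) v ≡ OD a v
    OD-old {v} v<n∸s̄ = trans (OD-++ a b v) (trans (cong (OD a v +_) (new-out-zero b∈ v<n∸s̄)) (+-identityʳ (OD a v)))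

    legal-restrict : Legal S (suc n) (a ++ b) → Legal S n a
    legal-restrict legal = record
      { in≤1  = λ v<n → subst (_≤ 1) (ID-old v<n) (in≤1 (≤-trans v<n (n≤1+n n)))
      ; out≤1 = λ {v} v<n → ≤-trans (m≤m+n (OD a v) (OD b v)) (subst (_≤ 1) (OD-++ a b v) (out≤1 (≤-trans v<n (n≤1+n n))))
      ; in≡1  = λ v<n s̄≤v → trans (sym (ID-old v<n)) (in≡1 (≤-trans v<n (n≤1+n n)) s̄≤v)
      ; out≡1 = λ {v} v<n∸s̄ → trans (sym (OD-old v<n∸s̄)) (out≡1 (subst (v <_) (sym n+1∸s̄) (≤-trans v<n∸s̄ (n≤1+n _))))
      }
      where open Legal legal

    odᵃ : ℕ → ℕ
    odᵃ = od S n (classOf S n a) b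

    od≡OD : Legal S n a → ∀ {v} → v ≤ n → n ∸ s̄ ≤ v → odᵃ v ≡ OD (a ++ b) v
    od≡OD legal {v} v≤n n∸s̄≤v with v ≡ᵇ n in v≟n
    ... | true  = sym (trans (cong (OD (a ++ b)) (≡ᵇ⇒≡ v n (Equivalence.from T-≡ v≟n)))
                             (trans (OD-++ a b n) (cong (_+ OD b n) (old-out-zero a∈))))
    ... | false = trans (cong (_+ OD b v) (trans (classOf-out s̄≤n legal (mirror<s̄ s̄≤n n∸s̄≤v v<n))
                                                 (cong (OD a) (mirror-involutive v<n))))
                        (sym (OD-++ a b v))
      where
      v<n : v < n
      v<n = ≤∧≢⇒< v≤n (λ v≡n → subst T v≟n (≡⇒≡ᵇ v n v≡n))

    record AlphaCondition (L R : Tup s̄) : Set where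
      field
        od≤1     : ∀ {v} → n ∸ s̄ ≤ v → v ≤ n → odᵃ v ≤ 1
        enters-n : ID b n ≡ 1
        od-first : odᵃ (n ∸ s̄) ≡ 1
        same-L   : ∀ {i} → i < s̄ → entry L i ≡ entry (proj₁ (classOf S n a)) i
        shift-R  : ∀ {i} → i < s̄ → entry R i ≡ odᵃ (n ∸ i)

    window-∈ : ∀ {v} → n ∸ s̄ ≤ v → v ≤ n → v ∈ n ∷ Rset S n
    window-∈ {v} n∸s̄≤v v≤n with v <? n
    ... | yes v<n = there (memℕ-sound (∈Rset⁺ S n v s̄≤n n∸s̄≤v v<n))
    ... | no  v≮n = here (≤∧≮⇒≡ v≤n v≮n)

    window-bounds : ∀ {v} → v ∈ n ∷ Rset S n → n ∸ s̄ ≤ v × v ≤ n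
    window-bounds (here refl) = m∸n≤m n s̄ , ≤-refl
    window-bounds {v} (there v∈R) with ∈Rset⁻ S n v s̄≤n (memℕ-complete v∈R)
    ... | n∸s̄≤v , v<n = n∸s̄≤v , <⇒≤ v<n

    alpha-sound : (L R : Tup s̄) → T (αcond S n (L , R) (classOf S n a) b) → AlphaCondition L R
    alpha-sound L R t with Equivalence.to (T-∧ {all (λ v → odᵃ v ≤ᵇ 1) (n ∷ Rset S n)}) t
    ... | window , t₁ with Equivalence.to (T-∧ {ID b n ≡ᵇ 1}) t₁
    ... | enters , t₂ with Equivalence.to (T-∧ {odᵃ (n ∸ s̄) ≡ᵇ 1}) t₂
    ... | first , t₃ with Equivalence.to (T-∧ {all (λ i → entry L i ≡ᵇ entry (proj₁ (classOf S n a)) i) (upTo s̄)}) t₃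
    ... | sameL , shiftR = record
      { od≤1     = λ {v} n∸s̄≤v v≤n → ≤ᵇ⇒≤ (odᵃ v) 1 (All.lookup (all⁺ _ (n ∷ Rset S n) window) (window-∈ n∸s̄≤v v≤n))
      ; enters-n = ≡ᵇ⇒≡ (ID b n) 1 enters
      ; od-first = ≡ᵇ⇒≡ (odᵃ (n ∸ s̄)) 1 first
      ; same-L   = λ {i} i<s̄ → ≡ᵇ⇒≡ (entry L i) _ (all-upTo⁻ _ s̄ sameL i<s̄)
      ; shift-R  = λ {i} i<s̄ → ≡ᵇ⇒≡ (entry R i) _ (all-upTo⁻ _ s̄ shiftR i<s̄)
      }

    alpha-complete : (L R : Tup s̄) → AlphaCondition L R → T (αcond S n (L , R) (classOf S n a) b)
    alpha-complete L R cond =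
      Equivalence.from T-∧ (window , Equivalence.from T-∧ (≡⇒≡ᵇ (ID b n) 1 enters-n ,
      Equivalence.from T-∧ (≡⇒≡ᵇ (odᵃ (n ∸ s̄)) 1 od-first , Equivalence.from T-∧ (sameL , shiftR))))
      where
      open AlphaCondition cond
      window : T (all (λ v → odᵃ v ≤ᵇ 1) (n ∷ Rset S n))
      window = all⁻ _ (All.tabulate (λ v∈ → ≤⇒≤ᵇ (od≤1 (proj₁ (window-bounds v∈)) (proj₂ (window-bounds v∈)))))
      sameL : T (all (λ i → entry L i ≡ᵇ entry (proj₁ (classOf S n a)) i) (upTo s̄))
      sameL = all-upTo⁺ _ s̄ (λ {i} i<s̄ → ≡⇒≡ᵇ (entry L i) _ (same-L i<s̄))
      shiftR : T (all (λ i → entry R i ≡ᵇ odᵃ (n ∸ i)) (upTo s̄))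
      shiftR = all-upTo⁺ _ s̄ (λ {i} i<s̄ → ≡⇒≡ᵇ (entry R i) _ (shift-R i<s̄))

    module _ (legal : Legal S n a) (L R : Tup s̄) where
      module old = Legal legal

      classified⁻ : T (classifiedAs S (suc n) (L , R) (a ++ b)) →
        ∀ {i} → i < s̄ → ID (a ++ b) i ≡ entry L i × OD (a ++ b) (n ∸ i) ≡ entry R i
      classified⁻ = all-eqs⁻ (ID (a ++ b)) (entry L) (λ i → OD (a ++ b) (n ∸ i)) (entry R) s̄
      classified⁺ : (∀ {i} → i < s̄ → ID (a ++ b) i ≡ entry L i × OD (a ++ b) (n ∸ i) ≡ entry R i) →
        T (classifiedAs S (suc n) (L , R) (a ++ b))
      classified⁺ = all-eqs⁺ (ID (a ++ b)) (entry L) (λ i → OD (a ++ b) (n ∸ i)) (entry R) s̄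
      od-window : ∀ {i} → i < s̄ → odᵃ (n ∸ i) ≡ OD (a ++ b) (n ∸ i)
      od-window {i} i<s̄ = od≡OD legal (m∸n≤m n i) (∸-monoʳ-≤ n (<⇒≤ i<s̄))

      extension⇒alpha : T (isLegal S (suc n) (a ++ b) ∧ classifiedAs S (suc n) (L , R) (a ++ b)) →
        T (αcond S n (L , R) (classOf S n a) b)
      extension⇒alpha t with Equivalence.to (T-∧ {isLegal S (suc n) (a ++ b)}) t
      ... | t-legal , t-class = alpha-complete L R (record
        { od≤1     = λ {v} n∸s̄≤v v≤n → subst (_≤ 1) (sym (od≡OD legal v≤n n∸s̄≤v)) (ext.out≤1 (s≤s v≤n))
        ; enters-n = trans (sym ID-new) (ext.in≡1 (n<1+n n) s̄≤n)
        ; od-first = trans (od≡OD legal (m∸n≤m n s̄) ≤-refl) (ext.out≡1 (subst (n ∸ s̄ <_) (sym n+1∸s̄) (n<1+n _)))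
        ; same-L   = λ i<s̄ → trans (sym (proj₁ (classified⁻ t-class i<s̄)))
                               (trans (ID-old (<-≤-trans i<s̄ s̄≤n)) (sym (classOf-in s̄≤n legal i<s̄)))
        ; shift-R  = λ i<s̄ → trans (sym (proj₂ (classified⁻ t-class i<s̄))) (sym (od-window i<s̄))
        })
        where module ext = Legal (legal-sound S (suc n) s̄≤n+1 (a ++ b) t-legal)

      alpha⇒legal : AlphaCondition L R → Legal S (suc n) (a ++ b)
      alpha⇒legal cond = record { in≤1 = in≤1 ; out≤1 = out≤1 ; in≡1 = in≡1 ; out≡1 = out≡1 }
        where
        open AlphaCondition cond
        in≤1 : ∀ {v} → v < suc n → ID (a ++ b) v ≤ 1
        in≤1 v<n+1 with m<1+n⇒m<n∨m≡n v<n+1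
        ... | inj₁ v<n  = subst (_≤ 1) (sym (ID-old v<n)) (old.in≤1 v<n)
        ... | inj₂ refl = ≤-reflexive (trans ID-new enters-n)
        out≤1 : ∀ {v} → v < suc n → OD (a ++ b) v ≤ 1
        out≤1 {v} v<n+1 with v <? n ∸ s̄
        ... | yes v<n∸s̄ = subst (_≤ 1) (sym (OD-old v<n∸s̄)) (old.out≤1 (<-≤-trans v<n∸s̄ (m∸n≤m n s̄)))
        ... | no  v≮n∸s̄ = subst (_≤ 1) (od≡OD legal (m<1+n⇒m≤n v<n+1) (≮⇒≥ v≮n∸s̄)) (od≤1 (≮⇒≥ v≮n∸s̄) (m<1+n⇒m≤n v<n+1))
        in≡1 : ∀ {v} → v < suc n → s̄ ≤ v → ID (a ++ b) v ≡ 1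
        in≡1 v<n+1 s̄≤v with m<1+n⇒m<n∨m≡n v<n+1
        ... | inj₁ v<n  = trans (ID-old v<n) (old.in≡1 v<n s̄≤v)
        ... | inj₂ refl = trans ID-new enters-n
        out≡1 : ∀ {v} → v < suc n ∸ s̄ → OD (a ++ b) v ≡ 1
        out≡1 {v} v<n+1∸s̄ with v <? n ∸ s̄
        ... | yes v<n∸s̄ = trans (OD-old v<n∸s̄) (old.out≡1 v<n∸s̄)
        ... | no  v≮n∸s̄ = subst (λ w → OD (a ++ b) w ≡ 1) (sym v≡n∸s̄) (trans (sym (od≡OD legal (m∸n≤m n s̄) ≤-refl)) od-first)
          where
          v≡n∸s̄ : v ≡ n ∸ s̄
          v≡n∸s̄ = ≤∧≮⇒≡ (m<1+n⇒m≤n (subst (v <_) n+1∸s̄ v<n+1∸s̄)) v≮n∸s̄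

      alpha⇒classified : AlphaCondition L R → ∀ {i} → i < s̄ → ID (a ++ b) i ≡ entry L i × OD (a ++ b) (n ∸ i) ≡ entry R i
      alpha⇒classified cond i<s̄ =
        trans (ID-old (<-≤-trans i<s̄ s̄≤n)) (trans (sym (classOf-in s̄≤n legal i<s̄)) (sym (same-L i<s̄))) ,
        trans (sym (od-window i<s̄)) (sym (shift-R i<s̄))
        where open AlphaCondition cond

      alpha⇒extension : T (αcond S n (L , R) (classOf S n a) b) →
        T (isLegal S (suc n) (a ++ b) ∧ classifiedAs S (suc n) (L , R) (a ++ b))
      alpha⇒extension t = Equivalence.from T-∧
        (legal-complete S (suc n) s̄≤n+1 (a ++ b) (alpha⇒legal (alpha-sound L R t)) ,
         classified⁺ (alpha⇒classified (alpha-sound L R t)))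

      extension⇔alpha : (isLegal S (suc n) (a ++ b) ∧ classifiedAs S (suc n) (L , R) (a ++ b)) ≡ αcond S n (L , R) (classOf S n a) b
      extension⇔alpha = T-ext extension⇒alpha alpha⇒extension

  new-completions : (X : P S) {a : List Edge} → a ∈ subsets (EL S n) →
    count (λ b → isLegal S (suc n) (a ++ b) ∧ classifiedAs S (suc n) X (a ++ b)) (New S n)
      ≡ 𝕀 (isLegal S n a) * α S n X (classOf S n a)
  new-completions (L , R) {a} a∈ with isLegal S n a in legal≡
  ... | false = count-none _ (New S n) (λ b b∈ → ¬T⇒≡false (λ t → subst T legal≡ (legal-complete S n s̄≤n a
                  (legal-restrict a∈ b∈ (legal-sound S (suc n) s̄≤n+1 (a ++ b) (proj₁ (Equivalence.to T-∧ t)))))))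
  ... | true  = trans (count-cong _ _ (New S n) (λ b b∈ → extension⇔alpha a∈ b∈ legal L R)) (sym (+-identityʳ _))
    where
    legal : Legal S n a
    legal = legal-sound S n s̄≤n a (Equivalence.from T-≡ legal≡)

transfer : (S : List ℕ) (n : ℕ) → sbar S ≤ n → (p : List Edge → Bool) → PermInvariant p →
  (E : List Edge) → filterᵇ (λ e → memE e (EL S n)) E ≡ EL S n → (G : P S → ℕ) →
  (∀ a → a ∈ subsets (EL S n) →
     count (λ b → p (a ++ b)) (filterᵇ (λ e → not (memE e (EL S n))) E) ≡ 𝕀 (isLegal S n a) * G (classOf S n a)) →
  count p E ≡ sumP S (λ X → G X * TX S n X)
transfer S n s̄≤n p p-inv E first-part G completions = begin
    count p E
      ≡⟨ count-split p p-inv (λ e → memE e (EL S n)) E ⟩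
    sumOver (subsets (filterᵇ (λ e → memE e (EL S n)) E)) (λ a → count (λ b → p (a ++ b)) rest)
      ≡⟨ cong (λ E₁ → sumOver (subsets E₁) (λ a → count (λ b → p (a ++ b)) rest)) first-part ⟩
    sumOver (subsets (EL S n)) (λ a → count (λ b → p (a ++ b)) rest)
      ≡⟨ sumOver-cong (subsets (EL S n)) completions ⟩
    sumOver (subsets (EL S n)) (λ a → 𝕀 (isLegal S n a) * G (classOf S n a))
      ≡⟨ sum-by-classification S n s̄≤n G ⟨
    sumP S (λ X → G X * TX S n X) ∎
  where
  open ≡-Reasoning
  rest : List Edge
  rest = filterᵇ (λ e → not (memE e (EL S n))) E

≤-last : (x : ℕ) (xs : List ℕ) → Linked _<_ (x ∷ xs) → ∀ {y} → y ∈ x ∷ xs → y ≤ lastOr x xs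
≤-last x []       _              (here refl) = ≤-refl
≤-last x (z ∷ zs) (x<z Linked.∷ zs↑) (here refl) = ≤-trans (<⇒≤ x<z) (≤-last z zs zs↑ (here refl))
≤-last x (z ∷ zs) (_   Linked.∷ zs↑) (there y∈) = ≤-last z zs zs↑ y∈

lemma5 : (t : List ℕ) → Linked _<_ (0 ∷ t) → (n : ℕ) → 2 * sbar (0 ∷ t) ≤ n →
    (Tn (0 ∷ t) n ≡ sumP (0 ∷ t) (λ X → β (0 ∷ t) n X * TX (0 ∷ t) n X))
    × ((X : P (0 ∷ t)) →
        TX (0 ∷ t) (suc n) X ≡ sumP (0 ∷ t) (λ X' → α (0 ∷ t) n X X' * TX (0 ∷ t) n X'))
lemma5 t increasing n 2s̄≤n =
    transfer S n s̄≤n (isCycleCover n) (isCycleCover-↭ n) (EC S n) (EC-restrict n) (β S n)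
      (λ a _ → hook-completions a)
  , λ X → transfer S n s̄≤n _ (legal∧classified-↭ S (suc n) X) (EL S (suc n)) (EL-restrict n) (α S n X)
      (λ a a∈ → new-completions X a∈)
  where
  S : List ℕ
  S = 0 ∷ t
  s̄≤n : sbar S ≤ n
  s̄≤n = ≤-trans (m≤m+n (sbar S) (sbar S + 0)) 2s̄≤n
  open EdgeSets S (≤-last 0 t increasing) using (EC-restrict; EL-restrict)
  open HookCompletion S (≤-last 0 t increasing) n s̄≤n using (hook-completions)
  open NewCompletion S (≤-last 0 t increasing) n s̄≤n using (new-completions)
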